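{- Let $D=(V,E)$ be a finite digraph without loops, $H=(U,F)$ a digraph (loops allowed), $\varsigma\colon E\to U$ an $H$-colouring of $D$, and $E=E_1\sqcup E_2$ a partition of the arcs, $D_1=(V,E_1)$. Let $\mathcal{S}=\mathcal{S}(D)$ be the $H$-semikernel digraph of $D$ modulo $E_1$. If every directed cycle of $D$ contained in $E_1$ is an $H$-cycle, then $\mathcal{S}$ is acyclic.
   Context: An $H$-colouring is a function $\varsigma\colon E\to U$. A walk $z_0\dots z_k$ ($k\ge1$) in $D$ is an $H$-walk if for each $1\le i\le k-1$, $\varsigma(z_{i-1}z_i)\varsigma(z_iz_{i+1})\in F$. A directed cycle is an $H$-cycle if the colours of its arcs, read cyclically, form a closed walk in $H$. A set $S\subseteq V$ is $H$-independent if there is no $H$-walk between two distinct elements of $S$. $S\subseteq V$ is an $H$-semikernel modulo $E_1$ if $S$ is $H$-independent and for every $z\in V\setminus S$, whenever there is an $H$-walk with all arcs in $E_2$ from a vertex of $S$ to $z$, there is an $H$-walk in $D$ from $z$ to a vertex of $S$. The $H$-semikernel digraph $\mathcal{S}(D)$ modulo $E_1$ has as vertices the nonempty $H$-semikernels modulo $E_1$, and an arc from $S_1$ to $S_2$ ($S_1\ne S_2$) iff for every $s_1\in S_1\setminus S_2$ there exists $s_2\in S_2\setminus S_1$ such that there is an $H$-walk from $s_1$ to $s_2$ with all arcs in $E_1$ and there is no $H$-walk in $D$ from $s_2$ to any vertex of $S_1$. -}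

module Defs where

open import Level using (Level; _⊔_) renaming (suc to lsuc)
open import Data.Nat using (ℕ; zero; suc; _≤_) renaming (_<?_ to _<ℕ?_)
open import Data.Bool using (Bool; true; false; T)
open import Data.Fin using (Fin; zero; suc; toℕ; fromℕ<)
open import Data.Fin.Subset using (Subset; _∈_; _∉_)
open import Data.Product using (Σ; ∃; ∃-syntax; _×_; _,_)
open import Data.Sum using (_⊎_)
open import Relation.Nullary using (¬_; yes; no)
open import Relation.Binary.PropositionalEquality using (_≡_; _≢_)
open import Function.Definitions using (Injective)

nextF : ∀ {k} → Fin (suc k) → Fin (suc k)
nextF {k} i with toℕ i <ℕ? k
... | yes p = suc (fromℕ< p)
... | no _  = zero

record DirCycle {a r} {X : Set a} (R : X → X → Set r) : Set (a ⊔ r) where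
  field
    len     : ℕ                       -- number of vertices minus one
    len≥1   : 1 ≤ len
    vtx     : Fin (suc len) → X
    distinct : Injective _≡_ _≡_ vtx
    arcs    : ∀ i → R (vtx i) (vtx (nextF i))

open DirCycle public

Acyclic : ∀ {a r} {X : Set a} → (X → X → Set r) → Set (a ⊔ r)
Acyclic R = ¬ DirCycle R

module Setting
  {u f : Level}
  (n : ℕ)                              -- D has vertex set V = Fin n
  (E₁ E₂ : Fin n → Fin n → Bool)       -- the two parts of the arc set E = E₁ ⊔ E₂
  (U : Set u) (F : U → U → Set f)      -- H = (U , F), loops allowed
  (ς : Fin n → Fin n → U)              -- colouring; only values on arcs matter
  where

  A₁ A₂ A : Fin n → Fin n → Set
  A₁ x y = T (E₁ x y)
  A₂ x y = T (E₂ x y)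
  A x y = A₁ x y ⊎ A₂ x y

  -- HW R x y z : an H-walk using only arcs in R, whose first arc is x→y and
  -- which ends at z.  Consecutive arcs (a,b),(b,c) must satisfy F (ς a b) (ς b c).
  data HW (R : Fin n → Fin n → Set) : Fin n → Fin n → Fin n → Set f where
    one  : ∀ {x y} → R x y → HW R x y y
    cons : ∀ {x y w z} → R x y → F (ς x y) (ς y w) → HW R y w z → HW R x y z

  HWalk : (Fin n → Fin n → Set) → Fin n → Fin n → Set f
  HWalk R x z = ∃[ y ] HW R x y z

  HIndependent : Subset n → Set f
  HIndependent S = ∀ s t → s ∈ S → t ∈ S → s ≢ t → ¬ HWalk A s t

  HSemikernel : Subset n → Set f
  HSemikernel S =
    HIndependent S ×
    (∀ z → z ∉ S → (∃[ s ] (s ∈ S × HWalk A₂ s z)) → ∃[ s ] (s ∈ S × HWalk A z s))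

  SKVertex : Set f
  SKVertex = Σ (Subset n) λ S → (∃[ x ] x ∈ S) × HSemikernel S

  SKArc : SKVertex → SKVertex → Set f
  SKArc (S₁ , _) (S₂ , _) =
    S₁ ≢ S₂ ×
    (∀ s₁ → s₁ ∈ S₁ → s₁ ∉ S₂ →
      ∃[ s₂ ] (s₂ ∈ S₂ × s₂ ∉ S₁ × HWalk A₁ s₁ s₂ ×
               (∀ s → s ∈ S₁ → ¬ HWalk A s₂ s)))

  IsHCycle : DirCycle A₁ → Set f
  IsHCycle c = ∀ i → F (ς (vtx c i) (vtx c (nextF i)))
                       (ς (vtx c (nextF i)) (vtx c (nextF (nextF i))))

module Submission where

-- Call a step s ⇒ t strict if there is an H-walk of D₁ from s to t but no H-walk
-- of D from t back to s.  The heart of the proof is that strict steps admit no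
-- closed chain s₀ ⇒ s₁ ⇒ … ⇒ s₀ (`no-closed-chain`).  This is proved by strong
-- induction on the total length of a chain closed up by an arbitrary H-walk of D₁:
-- view H-walks of D₁ as paths in the line digraph of D₁ whose transitions are allowed
-- by H (`ArcWalk`), pick an arc y₀ of the chain minimal for reachability in that
-- digraph, and let Y be its strong component.  Because cycles of D₁ are H-cycles, a
-- walk that leaves Y can only come back to Y where it left it (`no-return-outside`);
-- cutting the chain where it leaves Y then produces a shorter closed chain.
--
-- The acyclicity of the semikernel digraph follows: along a directed cycle
-- S₀ → S₁ → … of semikernels, every vertex leaving some Sᵢ is sent by a strict step
-- to a vertex leaving a later Sⱼ; a leaving vertex minimal for chain reachability
-- then closes a chain of strict steps.

open import Defs
open import Level using (Level; _⊔_)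
open import Data.Nat using (ℕ; zero; suc; _+_; _≤_; _<_; z≤n; s≤s) renaming (_<?_ to _<ℕ?_)
open import Data.Nat.Properties
  using (≤-refl; ≤-trans; ≤-pred; +-suc; +-comm; +-assoc; +-mono-≤; m≤m+n; m≤n+m; <-irrefl)
open import Data.Bool using (Bool; false; T)
open import Data.Fin using (Fin; zero; suc; toℕ; fromℕ; inject₁) renaming (_≟_ to _≟F_)
open import Data.Fin.Properties
  using (toℕ-injective; toℕ-fromℕ<; toℕ-inject₁; toℕ-fromℕ; toℕ<n; ≤fromℕ)
open import Data.Fin.Induction using (<-weakInduction; <-weakInduction-startingFrom)
open import Data.Fin.Subset using (Subset) renaming (_∈_ to _∈ₛ_; _∉_ to _∉ₛ_; _⊆_ to _⊆ₛ_)
open import Data.Fin.Subset.Properties using (⊆-antisym) renaming (_∈?_ to _∈ₛ?_)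
open import Data.Product using (Σ; ∃; ∃-syntax; _×_; _,_; proj₁; proj₂)
open import Data.Sum using (_⊎_; inj₁; inj₂; [_,_]′)
open import Data.Empty using (⊥; ⊥-elim)
open import Data.Unit using (⊤; tt)
open import Data.List using (List; []; _∷_; _++_; allFin; cartesianProduct)
open import Data.List.Relation.Unary.Any using (here; there)
open import Data.List.Membership.Propositional using (_∈_; _∉_)
open import Data.List.Membership.Propositional.Properties
  using (∈-++⁺ˡ; ∈-++⁺ʳ; ∈-++⁻; ∈-allFin; ∈-cartesianProduct⁺)
open import Data.List.Relation.Binary.Subset.Propositional using (_⊆_)
open import Function using (case_of_)
open import Relation.Nullary using (¬_; yes; no)
open import Relation.Nullary.Negation using (¬¬-map)
open import Relation.Binary.PropositionalEquality
  using (_≡_; _≢_; refl; sym; trans; cong; subst; subst₂)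

-- Refuting a statement by cases on an arbitrary proposition Q: the classical
-- reasoning of the proof is valid because all its goals are negations.
by-cases : ∀ {ℓ} (Q : Set ℓ) → (Q → ⊥) → (¬ Q → ⊥) → ⊥
by-cases Q refute-Q refute-¬Q = refute-¬Q refute-Q

nextF-inject₁ : ∀ {k} (j : Fin k) → nextF (inject₁ j) ≡ suc j
nextF-inject₁ {k} j with toℕ (inject₁ j) <ℕ? k
... | yes p = cong suc (toℕ-injective (trans (toℕ-fromℕ< p) (toℕ-inject₁ j)))
... | no ¬p = ⊥-elim (¬p (subst (_< k) (sym (toℕ-inject₁ j)) (toℕ<n j)))

nextF-fromℕ : ∀ k → nextF (fromℕ k) ≡ zero
nextF-fromℕ k with toℕ (fromℕ k) <ℕ? k
... | yes p = ⊥-elim (<-irrefl (toℕ-fromℕ k) p)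
... | no _  = refl

inject₁-or-last : ∀ {k} (j : Fin (suc k)) → (∃[ j′ ] j ≡ inject₁ j′) ⊎ j ≡ fromℕ k
inject₁-or-last {zero}  zero    = inj₂ refl
inject₁-or-last {suc k} zero    = inj₁ (zero , refl)
inject₁-or-last {suc k} (suc j) with inject₁-or-last j
... | inj₁ (j′ , e) = inj₁ (suc j′ , cong suc e)
... | inj₂ e        = inj₂ (cong suc e)

around-the-cycle : ∀ {ℓ k} (P : Fin (suc k) → Set ℓ) → (∀ j → P j → P (nextF j)) →
                   ∀ {i} → P i → ∀ j → P j
around-the-cycle {k = k} P step {i} Pi = <-weakInduction P P-zero step-suc
  where
  step-suc : ∀ j → P (inject₁ j) → P (suc j)
  step-suc j p = subst P (nextF-inject₁ j) (step _ p)
  P-zero : P zero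
  P-zero = subst P (nextF-fromℕ k) (step _ (<-weakInduction-startingFrom P Pi step-suc (≤fromℕ i)))

-- Classical minimal elements of a finite list under a preorder

module _ {a r p} {X : Set a} (_≼_ : X → X → Set r) (P : X → Set p) where

  Minimal : List X → X → Set (a ⊔ r ⊔ p)
  Minimal L m = m ∈ L × P m × (∀ {e} → e ∈ L → P e → e ≼ m → ¬ ¬ (m ≼ e))

  -- A finite list containing a P-element has a minimal P-element (double-negated,
  -- since comparability in a preorder is not decidable in general).
  minimal-exists : (∀ {x} → x ≼ x) → (∀ {x y z} → x ≼ y → y ≼ z → x ≼ z) →
                   ∀ L → ¬ ¬ (∃[ e ] (e ∈ L × P e)) → ¬ ¬ ∃ (Minimal L)
  minimal-exists ≼-refl ≼-trans [] nonempty _ = nonempty λ { (_ , () , _) }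
  minimal-exists ≼-refl ≼-trans (x ∷ L) nonempty noMinimal =
    by-cases (∃[ e ] (e ∈ L × P e))
      (λ inL → minimal-exists ≼-refl ≼-trans L (λ k → k inL) λ { (m , m∈L , Pm , m-min) →
         by-cases (P x × x ≼ m × ¬ (m ≼ x))
           (λ { (Px , x≼m , m⋠x) → noMinimal (x , here refl , Px , x-below-m x≼m m-min) })
           (λ notBelow → noMinimal (m , there m∈L , Pm , m-still-min notBelow m-min)) })
      (λ notInL → nonempty λ
         { (e , here refl , Pe) → noMinimal (e , here refl , Pe , only-x notInL)
         ; (e , there e∈L , Pe) → notInL (e , e∈L , Pe) })
    where
    x-below-m : ∀ {m} → x ≼ m → (∀ {e} → e ∈ L → P e → e ≼ m → ¬ ¬ (m ≼ e)) →
                ∀ {e} → e ∈ x ∷ L → P e → e ≼ x → ¬ ¬ (x ≼ e)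
    x-below-m x≼m m-min (here refl) _ _ = λ k → k ≼-refl
    x-below-m x≼m m-min (there e∈L) Pe e≼x =
      ¬¬-map (≼-trans x≼m) (m-min e∈L Pe (≼-trans e≼x x≼m))
    m-still-min : ∀ {m} → ¬ (P x × x ≼ m × ¬ (m ≼ x)) →
                  (∀ {e} → e ∈ L → P e → e ≼ m → ¬ ¬ (m ≼ e)) →
                  ∀ {e} → e ∈ x ∷ L → P e → e ≼ m → ¬ ¬ (m ≼ e)
    m-still-min notBelow m-min (here refl) Px x≼m m⋠x = notBelow (Px , x≼m , m⋠x)
    m-still-min notBelow m-min (there e∈L) = m-min e∈L
    only-x : ¬ (∃[ e ] (e ∈ L × P e)) → ∀ {e} → e ∈ x ∷ L → P e → e ≼ x → ¬ ¬ (x ≼ e)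
    only-x notInL (here refl) _ _ = λ k → k ≼-refl
    only-x notInL (there e∈L) Pe _ = ⊥-elim (notInL (_ , e∈L , Pe))

module Acyclicity {u f : Level} (n : ℕ) (E₁ E₂ : Fin n → Fin n → Bool)
  (U : Set u) (F : U → U → Set f) (ς : Fin n → Fin n → U)
  (E₁-loopless : ∀ x → E₁ x x ≡ false)
  (E₁-cycles-are-H : ∀ (c : DirCycle (Setting.A₁ n E₁ E₂ U F ς)) → Setting.IsHCycle n E₁ E₂ U F ς c)
  where

  open Setting n E₁ E₂ U F ς
  open import Data.List.Membership.DecPropositional (_≟F_ {n}) using (_∈?_)

  V : Set
  V = Fin n

  no-loop : ∀ {x} → ¬ A₁ x x
  no-loop {x} a = subst T (E₁-loopless x) a

  -- H-walks of D₁ as paths in its line digraph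

  -- ArcWalk x y w z: an H-walk of D₁ starting with the arc xy and ending with the
  -- arc wz; consecutive arcs are H-compatible.
  data ArcWalk : V → V → V → V → Set f where
    start : ∀ {x y} → A₁ x y → ArcWalk x y x y
    step  : ∀ {x y v w z} → A₁ x y → F (ς x y) (ς y v) → ArcWalk y v w z → ArcWalk x y w z

  firstArc : ∀ {x y w z} → ArcWalk x y w z → A₁ x y
  firstArc (start a)    = a
  firstArc (step a _ _) = a

  lastArc : ∀ {x y w z} → ArcWalk x y w z → A₁ w z
  lastArc (start a)    = a
  lastArc (step _ _ p) = lastArc p

  infixr 5 _++ₐ_
  _++ₐ_ : ∀ {x y w z p q} → ArcWalk x y w z → ArcWalk w z p q → ArcWalk x y p q
  start _    ++ₐ q = q
  step a g p ++ₐ q = step a g (p ++ₐ q)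

  snoc : ∀ {x y w z q} → ArcWalk x y w z → F (ς w z) (ς z q) → A₁ z q → ArcWalk x y z q
  snoc (start a)     g b = step a g (start b)
  snoc (step a g′ p) g b = step a g′ (snoc p g b)

  unsnoc : ∀ {x y w z} → ArcWalk x y w z →
           (x ≡ w × y ≡ z) ⊎ (∃[ p ] (ArcWalk x y p w × F (ς p w) (ς w z)))
  unsnoc (start a) = inj₁ (refl , refl)
  unsnoc (step a g p) with unsnoc p
  ... | inj₁ (refl , refl)   = inj₂ (_ , start a , g)
  ... | inj₂ (q , p′ , g′)   = inj₂ (q , step a g p′ , g′)

  arcWalk→hwalk : ∀ {x y w z} → ArcWalk x y w z → HW A₁ x y z
  arcWalk→hwalk (start a)    = one a
  arcWalk→hwalk (step a g p) = cons a g (arcWalk→hwalk p)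

  hwalk₁→hwalk : ∀ {x y z} → HW A₁ x y z → HW A x y z
  hwalk₁→hwalk (one a)      = one (inj₁ a)
  hwalk₁→hwalk (cons a g h) = cons (inj₁ a) g (hwalk₁→hwalk h)

  data Walk : V → V → Set where
    []  : ∀ {x} → Walk x x
    _∷_ : ∀ {x y z} → A₁ x y → Walk y z → Walk x z

  infixr 5 _++ʷ_
  _++ʷ_ : ∀ {x y z} → Walk x y → Walk y z → Walk x z
  []      ++ʷ w = w
  (a ∷ v) ++ʷ w = a ∷ (v ++ʷ w)

  size : ∀ {x y} → Walk x y → ℕ
  size []      = 0
  size (_ ∷ w) = suc (size w)

  vertices : ∀ {x y} → Walk x y → List V
  vertices {x} []      = x ∷ []
  vertices {x} (_ ∷ w) = x ∷ vertices w

  tails : ∀ {x y} → Walk x y → List V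
  tails []          = []
  tails {x} (_ ∷ w) = x ∷ tails w

  arcList : ∀ {x y} → Walk x y → List (V × V)
  arcList []                      = []
  arcList {x} (_∷_ {y = y} _ w) = (x , y) ∷ arcList w

  AllArcs : ∀ {x y} → (V → V → Set f) → Walk x y → Set f
  AllArcs P w = ∀ {e} → e ∈ arcList w → P (proj₁ e) (proj₂ e)

  Distinct : List V → Set
  Distinct []       = ⊤
  Distinct (x ∷ xs) = (x ∉ xs) × Distinct xs

  size-++ : ∀ {x y z} (w : Walk x y) (v : Walk y z) → size (w ++ʷ v) ≡ size w + size v
  size-++ []      v = refl
  size-++ (a ∷ w) v = cong suc (size-++ w v)

  tails-++ : ∀ {x y z} (w : Walk x y) (v : Walk y z) → tails (w ++ʷ v) ≡ tails w ++ tails v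
  tails-++ []      v = refl
  tails-++ (a ∷ w) v = cong (_ ∷_) (tails-++ w v)

  arcList-++ : ∀ {x y z} (w : Walk x y) (v : Walk y z) → arcList (w ++ʷ v) ≡ arcList w ++ arcList v
  arcList-++ []      v = refl
  arcList-++ (a ∷ w) v = cong (_ ∷_) (arcList-++ w v)

  allArcs-++ : ∀ {x y z} {P : V → V → Set f} (w : Walk x y) (v : Walk y z) →
               AllArcs P w → AllArcs P v → AllArcs P (w ++ʷ v)
  allArcs-++ w v Pw Pv m with ∈-++⁻ (arcList w) (subst (_ ∈_) (arcList-++ w v) m)
  ... | inj₁ k = Pw k
  ... | inj₂ k = Pv k

  distinct-++ : ∀ xs ys → Distinct xs → Distinct ys → (∀ {v} → v ∈ xs → v ∈ ys → ⊥) →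
                Distinct (xs ++ ys)
  distinct-++ []       ys _          dys _        = dys
  distinct-++ (x ∷ xs) ys (x∉xs , dxs) dys disjoint =
    x∉xs++ys , distinct-++ xs ys dxs dys (λ m k → disjoint (there m) k)
    where
    x∉xs++ys : x ∉ xs ++ ys
    x∉xs++ys m with ∈-++⁻ xs m
    ... | inj₁ k = x∉xs k
    ... | inj₂ k = disjoint (here refl) k

  first∈vertices : ∀ {x y} (w : Walk x y) → x ∈ vertices w
  first∈vertices []      = here refl
  first∈vertices (_ ∷ _) = here refl

  last∈vertices : ∀ {x y} (w : Walk x y) → y ∈ vertices w
  last∈vertices []      = here refl
  last∈vertices (a ∷ w) = there (last∈vertices w)

  tails⊆vertices : ∀ {x y} (w : Walk x y) → tails w ⊆ vertices w
  tails⊆vertices (a ∷ w) (here e)  = here e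
  tails⊆vertices (a ∷ w) (there m) = there (tails⊆vertices w m)

  distinct-tails : ∀ {x y} (w : Walk x y) → Distinct (vertices w) → Distinct (tails w)
  distinct-tails []      _          = tt
  distinct-tails (a ∷ w) (x∉ , d) = (λ m → x∉ (tails⊆vertices w m)) , distinct-tails w d

  last∉tails : ∀ {x y} (w : Walk x y) → Distinct (vertices w) → y ∉ tails w
  last∉tails []      _          ()
  last∉tails (a ∷ w) (x∉ , d) (here e)  = x∉ (subst (_∈ vertices w) e (last∈vertices w))
  last∉tails (a ∷ w) (x∉ , d) (there m) = last∉tails w d m

  tail-has-arc : ∀ {x y v} (w : Walk x y) → v ∈ tails w → ∃[ b ] ((v , b) ∈ arcList w)
  tail-has-arc (a ∷ w) (here refl) = _ , here refl
  tail-has-arc (a ∷ w) (there m) with tail-has-arc w m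
  ... | b , k = b , there k

  head∈vertices : ∀ {y z e} (w : Walk y z) → e ∈ arcList w → proj₂ e ∈ vertices w
  head∈vertices (a ∷ w) (here refl) = there (first∈vertices w)
  head∈vertices (a ∷ w) (there m)   = there (head∈vertices w m)

  arc-into-start : ∀ {x y z q} (a : A₁ x y) (w : Walk y z) → (q , x) ∈ arcList (a ∷ w) → x ∈ vertices w
  arc-into-start a w (here refl) = first∈vertices w
  arc-into-start a w (there m)   = head∈vertices w m

  arc∈walk-valid : ∀ {x y e} (w : Walk x y) → e ∈ arcList w → A₁ (proj₁ e) (proj₂ e)
  arc∈walk-valid (a ∷ w) (here refl) = a
  arc∈walk-valid (a ∷ w) (there m)   = arc∈walk-valid w m

  suffix : ∀ {x y z} (w : Walk y z) → x ∈ vertices w →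
    Σ (Walk x z) λ w′ → (vertices w′ ⊆ vertices w) × (arcList w′ ⊆ arcList w) ×
                        (Distinct (vertices w) → Distinct (vertices w′))
  suffix []      (here refl) = [] , (λ m → m) , (λ m → m) , (λ d → d)
  suffix (a ∷ w) (here refl) = (a ∷ w) , (λ m → m) , (λ m → m) , (λ d → d)
  suffix (a ∷ w) (there m) with suffix w m
  ... | w′ , vs , as , ds = w′ , (λ k → there (vs k)) , (λ k → there (as k)) , (λ d → ds (proj₂ d))

  simplify : ∀ {x y} (w : Walk x y) →
    Σ (Walk x y) λ w′ → Distinct (vertices w′) × (vertices w′ ⊆ vertices w) ×
                        (arcList w′ ⊆ arcList w)
  simplify [] = [] , ((λ ()) , tt) , (λ m → m) , (λ m → m)
  simplify {x} (a ∷ w) with simplify w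
  ... | w′ , d , vs , as with x ∈? vertices w′
  ...   | yes m with suffix w′ m
  ...     | w″ , vs′ , as′ , ds =
    w″ , ds d , (λ k → there (vs (vs′ k))) , (λ k → there (as (as′ k)))
  simplify {x} (a ∷ w) | w′ , d , vs , as | no x∉ =
    (a ∷ w′) , (x∉ , d) , vertices⊆ , arcs⊆
    where
    vertices⊆ : vertices (a ∷ w′) ⊆ vertices (a ∷ w)
    vertices⊆ (here e)  = here e
    vertices⊆ (there k) = there (vs k)
    arcs⊆ : arcList (a ∷ w′) ⊆ arcList (a ∷ w)
    arcs⊆ (here e)  = here e
    arcs⊆ (there k) = there (as k)

  -- Simple closed walks of D₁ are H-cycles

  tailAt : ∀ {x y} (w : Walk x y) → Fin (size w) → V
  tailAt {x} (_ ∷ w) zero    = x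
  tailAt     (_ ∷ w) (suc i) = tailAt w i

  headAt : ∀ {x y} (w : Walk x y) → Fin (size w) → V
  headAt (_∷_ {y = y} _ w) zero = y
  headAt (_ ∷ w)       (suc i) = headAt w i

  arcAt : ∀ {x y} (w : Walk x y) (i : Fin (size w)) → A₁ (tailAt w i) (headAt w i)
  arcAt (a ∷ w) zero    = a
  arcAt (a ∷ w) (suc i) = arcAt w i

  tailAt∈tails : ∀ {x y} (w : Walk x y) (i : Fin (size w)) → tailAt w i ∈ tails w
  tailAt∈tails (a ∷ w) zero    = here refl
  tailAt∈tails (a ∷ w) (suc i) = there (tailAt∈tails w i)

  tailAt-injective : ∀ {x y} (w : Walk x y) → Distinct (tails w) →
                     ∀ i j → tailAt w i ≡ tailAt w j → i ≡ j
  tailAt-injective (a ∷ w) d zero    zero    e = refl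
  tailAt-injective (a ∷ w) d zero    (suc j) e =
    ⊥-elim (proj₁ d (subst (_∈ tails w) (sym e) (tailAt∈tails w j)))
  tailAt-injective (a ∷ w) d (suc i) zero    e =
    ⊥-elim (proj₁ d (subst (_∈ tails w) e (tailAt∈tails w i)))
  tailAt-injective (a ∷ w) d (suc i) (suc j) e = cong suc (tailAt-injective w (proj₂ d) i j e)

  headAt-inject₁ : ∀ {x y z} (a : A₁ x y) (w : Walk y z) (j : Fin (size w)) →
                   headAt (a ∷ w) (inject₁ j) ≡ tailAt w j
  headAt-inject₁ a (b ∷ w) zero    = refl
  headAt-inject₁ a (b ∷ w) (suc j) = headAt-inject₁ b w j

  headAt-last : ∀ {x y z} (a : A₁ x y) (w : Walk y z) → headAt (a ∷ w) (fromℕ (size w)) ≡ z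
  headAt-last a []      = refl
  headAt-last a (b ∷ w) = headAt-last b w

  lastArc∈ : ∀ {x y z} (a : A₁ x y) (w : Walk y z) →
             (tailAt (a ∷ w) (fromℕ (size w)) , z) ∈ arcList (a ∷ w)
  lastArc∈ a []      = here refl
  lastArc∈ a (b ∷ w) = there (lastArc∈ b w)

  colourAt : ∀ {x y} (w : Walk x y) → Fin (size w) → U
  colourAt w i = ς (tailAt w i) (headAt w i)

  arcWalk-along : ∀ {x y z} (a : A₁ x y) (w : Walk y z) →
    (∀ (j : Fin (size w)) → F (colourAt (a ∷ w) (inject₁ j)) (colourAt w j)) →
    ArcWalk x y (tailAt (a ∷ w) (fromℕ (size w))) z
  arcWalk-along a []      compat = start a
  arcWalk-along a (b ∷ w) compat = step a (compat zero) (arcWalk-along b w (λ j → compat (suc j)))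

  module _ {x y : V} (a : A₁ x y) (w : Walk y x) (nontrivial : 1 ≤ size w)
           (distinct : Distinct (tails (a ∷ w))) where
    private
      c : Walk x x
      c = a ∷ w

      last : Fin (suc (size w))
      last = fromℕ (size w)

      tail-next : ∀ j → tailAt c (nextF j) ≡ headAt c j
      tail-next j with inject₁-or-last j
      ... | inj₁ (j′ , refl) = trans (cong (tailAt c) (nextF-inject₁ j′)) (sym (headAt-inject₁ a w j′))
      ... | inj₂ refl        = trans (cong (tailAt c) (nextF-fromℕ (size w))) (sym (headAt-last a w))

      cycle : DirCycle A₁
      cycle = record
        { len      = size w
        ; len≥1    = nontrivial
        ; vtx      = tailAt c
        ; distinct = λ {i} {j} → tailAt-injective c distinct i j
        ; arcs     = λ i → subst (A₁ (tailAt c i)) (sym (tail-next i)) (arcAt c i) }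

      compatible : ∀ i → F (colourAt c i) (colourAt c (nextF i))
      compatible i = subst₂ (λ h h′ → F (ς (tailAt c i) h) (ς (tailAt c (nextF i)) h′))
                            (tail-next i) (tail-next (nextF i)) (E₁-cycles-are-H cycle i)

    simple-cycle-is-H : ArcWalk x y (tailAt (a ∷ w) (fromℕ (size w))) x ×
                        F (ς (tailAt (a ∷ w) (fromℕ (size w))) x) (ς x y)
    simple-cycle-is-H = arcWalk-along a w compatible-inner
                      , subst (λ z → F (ς (tailAt c last) z) (ς x y)) (headAt-last a w) closing
      where
      compatible-inner : ∀ (j : Fin (size w)) → F (colourAt c (inject₁ j)) (colourAt w j)
      compatible-inner j = subst (λ k → F (colourAt c (inject₁ j)) (colourAt c k))
                                 (nextF-inject₁ j) (compatible (inject₁ j))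
      closing : F (colourAt c last) (ς x y)
      closing = subst (λ k → F (colourAt c last) (colourAt c k)) (nextF-fromℕ (size w)) (compatible last)

  -- The strong component of an arc in the line digraph

  module Component {ya yb : V} (y₀ : A₁ ya yb) where

    -- the arc ab lies in the strong component Y of y₀ = ya yb in the line digraph
    InY : V → V → Set f
    InY a b = ArcWalk a b ya yb × ArcWalk ya yb a b

    NonY : V → V → Set f
    NonY a b = ¬ InY a b

    y₀∈Y : InY ya yb
    y₀∈Y = start y₀ , start y₀

    YTail : V → Set f
    YTail v = ∃[ w ] InY v w

    walk-within-Y : ∀ {x y w z} → ArcWalk x y w z → ArcWalk ya yb x y → ArcWalk w z ya yb →
                    Σ (Walk x z) (AllArcs InY)
    walk-within-Y (start a) into out = (a ∷ []) , λ { (here refl) → out , into }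
    walk-within-Y (step a g p) into out with walk-within-Y p (snoc into g (firstArc p)) out
    ... | ω , ω⊆Y = (a ∷ ω) , λ { (here refl) → (step a g p ++ₐ out) , into ; (there m) → ω⊆Y m }

    record ToFirstYTail (z : V) : Set f where
      constructor mkCut
      field
        target       : V
        walk         : Walk z target
        target∈Y     : YTail target
        z≢target     : z ≢ target
        simple       : Distinct (vertices walk)
        tails-beside : ∀ {v} → v ∈ tails walk → v ≡ z ⊎ ¬ YTail v

    CutWithin : ∀ {z c} → Walk z c → Set f
    CutWithin {z} w = Σ (ToFirstYTail z) λ k →
      arcList (ToFirstYTail.walk k) ⊆ arcList w × vertices (ToFirstYTail.walk k) ⊆ vertices w

    first-YTail : ∀ {z c} (w : Walk z c) → YTail c → Distinct (vertices w) → z ≢ c → ¬ ¬ CutWithin w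
    first-YTail [] _ _ z≢c _ = z≢c refl
    first-YTail {z} (_∷_ {y = u} a w) c∈Y (z∉w , d) z≢c noCut =
      by-cases (YTail u)
        (λ u∈Y → noCut (stop-at u∈Y))
        (λ u∉Y → first-YTail w c∈Y d (λ e → u∉Y (subst YTail (sym e) c∈Y)) (λ cut → noCut (extend u∉Y cut)))
      where
      u∈w : ∀ {v} → v ≡ u → v ∈ vertices w
      u∈w e = subst (_∈ vertices w) (sym e) (first∈vertices w)
      z∉u : z ∉ u ∷ []
      z∉u (here e) = z∉w (u∈w e)

      stop-at : YTail u → CutWithin (a ∷ w)
      stop-at u∈Y =
        mkCut u (a ∷ []) u∈Y (λ e → no-loop (subst (A₁ z) (sym e) a)) (z∉u , (λ ()) , tt)
              (λ { (here e) → inj₁ e ; (there ()) })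
        , (λ { (here e) → here e ; (there ()) })
        , (λ { (here e) → here e ; (there (here e)) → there (u∈w e) ; (there (there ())) })

      extend : ¬ YTail u → CutWithin w → CutWithin (a ∷ w)
      extend u∉Y (mkCut t π t∈Y _ simple beside , arcs⊆ , vertices⊆) =
        mkCut t (a ∷ π) t∈Y (λ e → z∉w (vertices⊆ (subst (_∈ vertices π) (sym e) (last∈vertices π))))
              ((λ m → z∉w (vertices⊆ m)) , simple)
              (λ { (here e) → inj₁ e ; (there m) → inj₂ (λ v∈Y → not-u v∈Y (beside m)) })
        , (λ { (here e) → here e ; (there m) → there (arcs⊆ m) })
        , (λ { (here e) → here e ; (there m) → there (vertices⊆ m) })
        where
        not-u : ∀ {v} → YTail v → v ≡ u ⊎ ¬ YTail v → ⊥
        not-u v∈Y (inj₁ e)   = u∉Y (subst YTail e v∈Y)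
        not-u v∈Y (inj₂ v∉Y) = v∉Y v∈Y

    -- It is an H-cycle, so its last arc (in Y) leads on to its first
    -- arc, which would then lie in Y.
    no-mixed-cycle : ∀ {z t} → z ≢ t → (π : Walk z t) (ρ : Walk t z) →
      Distinct (vertices π) → Distinct (vertices ρ) → (∀ {v} → v ∈ tails π → v ≡ z ⊎ ¬ YTail v) →
      AllArcs NonY π → AllArcs InY ρ → ⊥
    no-mixed-cycle z≢t [] _ _ _ _ _ _ = z≢t refl
    no-mixed-cycle z≢t (_ ∷ _) [] _ _ _ _ _ = z≢t refl
    no-mixed-cycle {z} z≢t (a ∷ π₁) ρ@(b ∷ ρ₁) dπ dρ beside π∉Y ρ∈Y
      with simple-cycle-is-H a (π₁ ++ʷ ρ) nontrivial tails-distinct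
         | ∈-++⁻ (arcList (a ∷ π₁))
                 (subst ((lastTail , z) ∈_) (arcList-++ (a ∷ π₁) ρ) (lastArc∈ a (π₁ ++ʷ ρ)))
      where
      lastTail : V
      lastTail = tailAt (a ∷ (π₁ ++ʷ ρ)) (fromℕ (size (π₁ ++ʷ ρ)))
      nontrivial : 1 ≤ size (π₁ ++ʷ ρ)
      nontrivial = subst (1 ≤_) (sym (size-++ π₁ ρ)) (≤-trans (s≤s z≤n) (m≤n+m (size ρ) (size π₁)))
      disjoint : ∀ {v} → v ∈ tails (a ∷ π₁) → v ∈ tails ρ → ⊥
      disjoint m k with tail-has-arc ρ k | beside m
      ... | _    | inj₁ refl = last∉tails ρ dρ k
      ... | b′ , arc | inj₂ v∉Y = v∉Y (b′ , ρ∈Y arc)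
      tails-distinct : Distinct (tails (a ∷ (π₁ ++ʷ ρ)))
      tails-distinct = subst Distinct (sym (tails-++ (a ∷ π₁) ρ))
                         (distinct-++ _ _ (distinct-tails (a ∷ π₁) dπ) (distinct-tails ρ dρ) disjoint)
    ... | around , closing | inj₁ last∈π = proj₁ dπ (arc-into-start a π₁ last∈π)
    ... | around , closing | inj₂ last∈ρ =
      π∉Y (here refl) ( around ++ₐ proj₁ (ρ∈Y last∈ρ)
                      , proj₂ (ρ∈Y last∈ρ) ++ₐ step (lastArc around) closing (start a))

    -- A walk of D₁ avoiding Y cannot lead from the head z of an arc of Y to a Y-tail
    -- other than z: its first stretch to a Y-tail would close a mixed cycle.
    no-return-outside : ∀ {p z c} → InY p z → YTail c → z ≢ c →
                        (ω : Walk z c) → AllArcs NonY ω → ⊥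
    no-return-outside {z = z} pz∈Y c∈Y z≢c ω ω∉Y =
      let (π , dπ , _ , π⊆ω) = simplify ω in
      first-YTail π c∈Y dπ z≢c λ { (k , k⊆π , _) → close k (λ m → ω∉Y (π⊆ω (k⊆π m))) }
      where
      close : (k : ToFirstYTail z) → AllArcs NonY (ToFirstYTail.walk k) → ⊥
      close (mkCut t π′ (_ , tw∈Y) z≢t dπ′ beside) π′∉Y =
        let (ρ₀ , ρ₀∈Y) = walk-within-Y (proj₁ tw∈Y ++ₐ proj₂ pz∈Y) (proj₂ tw∈Y) (proj₁ pz∈Y)
            (ρ , dρ , _ , ρ⊆ρ₀) = simplify ρ₀
        in no-mixed-cycle z≢t π′ ρ dπ′ dρ beside π′∉Y (λ m → ρ₀∈Y (ρ⊆ρ₀ m))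

  Strict : V → V → Set f
  Strict x y = HWalk A₁ x y × ¬ HWalk A y x

  strict-irreflexive : ∀ {x} → ¬ Strict x x
  strict-irreflexive ((y , h) , no-back) = no-back (y , hwalk₁→hwalk h)

  data Chain : V → V → Set f where
    []  : ∀ {x} → Chain x x
    _∷_ : ∀ {x y z} → Strict x y → Chain y z → Chain x z

  infixr 5 _++ᶜ_
  _++ᶜ_ : ∀ {x y z} → Chain x y → Chain y z → Chain x z
  []      ++ᶜ d = d
  (s ∷ c) ++ᶜ d = s ∷ (c ++ᶜ d)

  steps : ∀ {x y} → Chain x y → ℕ
  steps []       = 0
  steps (_ ∷ ch) = suc (steps ch)

  steps-++-∷ : ∀ {x y z w} (pre : Chain x y) (s : Strict y z) (post : Chain z w) → 1 ≤ steps (pre ++ᶜ (s ∷ post))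
  steps-++-∷ []      s post = s≤s z≤n
  steps-++-∷ (_ ∷ _) s post = s≤s z≤n

  hwalk→walk : ∀ {x y z} → HW A₁ x y z → Walk x z
  hwalk→walk (one a)      = a ∷ []
  hwalk→walk (cons a g h) = a ∷ hwalk→walk h

  chain→walk : ∀ {x y} → Chain x y → Walk x y
  chain→walk []                  = []
  chain→walk (((_ , h) , _) ∷ ch) = hwalk→walk h ++ʷ chain→walk ch

  lenᴴ : ∀ {x y z} → HW A₁ x y z → ℕ
  lenᴴ h = size (hwalk→walk h)

  lenᵂ : ∀ {x z} → HWalk A₁ x z → ℕ
  lenᵂ (_ , h) = lenᴴ h

  lenᶜ : ∀ {x y} → Chain x y → ℕ
  lenᶜ []       = 0
  lenᶜ (s ∷ ch) = lenᵂ (proj₁ s) + lenᶜ ch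

  lenᶜ-++ : ∀ {x y z} (c : Chain x y) (d : Chain y z) → lenᶜ (c ++ᶜ d) ≡ lenᶜ c + lenᶜ d
  lenᶜ-++ []      d = refl
  lenᶜ-++ (s ∷ c) d =
    trans (cong (lenᵂ (proj₁ s) +_) (lenᶜ-++ c d)) (sym (+-assoc (lenᵂ (proj₁ s)) (lenᶜ c) (lenᶜ d)))

  lenᴴ≥1 : ∀ {x y z} (h : HW A₁ x y z) → 1 ≤ lenᴴ h
  lenᴴ≥1 (one a)      = s≤s z≤n
  lenᴴ≥1 (cons a g h) = s≤s z≤n

  arcsᴴ : ∀ {x y z} → HW A₁ x y z → List (V × V)
  arcsᴴ h = arcList (hwalk→walk h)

  arcsᵂ : ∀ {x z} → HWalk A₁ x z → List (V × V)
  arcsᵂ (_ , h) = arcsᴴ h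

  arcsᶜ : ∀ {x y} → Chain x y → List (V × V)
  arcsᶜ []       = []
  arcsᶜ (s ∷ ch) = arcsᵂ (proj₁ s) ++ arcsᶜ ch

  arcsᶜ-walk : ∀ {x y} (ch : Chain x y) → arcList (chain→walk ch) ≡ arcsᶜ ch
  arcsᶜ-walk []                  = refl
  arcsᶜ-walk (((_ , h) , _) ∷ ch) =
    trans (arcList-++ (hwalk→walk h) (chain→walk ch)) (cong (arcsᴴ h ++_) (arcsᶜ-walk ch))

  firstArc∈ : ∀ {x y z} (h : HW A₁ x y z) → (x , y) ∈ arcsᴴ h
  firstArc∈ (one a)      = here refl
  firstArc∈ (cons a g h) = here refl

  arcWalk-to : ∀ {x y z e} (h : HW A₁ x y z) → e ∈ arcsᴴ h → ArcWalk x y (proj₁ e) (proj₂ e)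
  arcWalk-to (one a)      (here refl) = start a
  arcWalk-to (cons a g h) (here refl) = start a
  arcWalk-to (cons a g h) (there m)   = step a g (arcWalk-to h m)

  Reaches : (V × V) → (V × V) → Set f
  Reaches e e′ = (e ≡ e′) ⊎ ArcWalk (proj₁ e) (proj₂ e) (proj₁ e′) (proj₂ e′)

  Reaches-trans : ∀ {e₁ e₂ e₃} → Reaches e₁ e₂ → Reaches e₂ e₃ → Reaches e₁ e₃
  Reaches-trans (inj₁ refl) r           = r
  Reaches-trans (inj₂ p)    (inj₁ refl) = inj₂ p
  Reaches-trans (inj₂ p)    (inj₂ q)    = inj₂ (p ++ₐ q)

  NoClosedChainUpTo : ℕ → Set f
  NoClosedChainUpTo N = ∀ {a b} (ch : Chain a b) → 1 ≤ steps ch → (q : HWalk A₁ b a) →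
                        lenᶜ ch + lenᵂ q ≤ N → ⊥

  shorter : ∀ {r s h} → 1 ≤ r → r + s ≡ h → suc s ≤ h
  shorter {r} {s} r≥1 e = subst (suc s ≤_) e (+-mono-≤ r≥1 (≤-refl {s}))

  drop-positive : ∀ {m q N} → 1 ≤ q → m + q ≤ suc N → m ≤ N
  drop-positive {m} {q} q≥1 b =
    ≤-pred (≤-trans (subst (_≤ m + q) (+-comm m 1) (+-mono-≤ (≤-refl {m}) q≥1)) b)

  -- Assume the statement for length N; the chain and closing walk under
  -- consideration have their arcs in L, and y₀ is an arc of L minimal for Reaches.
  module InductionStep (N : ℕ) (IH : NoClosedChainUpTo N) (L : List (V × V))
    {ya yb : V} (y₀ : A₁ ya yb)
    (y₀-minimal : ∀ {e} → e ∈ L → Reaches e (ya , yb) → ¬ ¬ Reaches (ya , yb) e) where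

    open Component y₀

    -- by minimality of y₀, an H-walk inside L whose first arc is outside Y never enters Y
    outside-stays-outside : ∀ {x y z} (h : HW A₁ x y z) → arcsᴴ h ⊆ L → NonY x y →
                            AllArcs NonY (hwalk→walk h)
    outside-stays-outside {x} {y} h h⊆L xy∉Y {e} m e∈Y =
      y₀-minimal (h⊆L (firstArc∈ h)) (inj₂ into-Y) λ
        { (inj₁ refl) → xy∉Y (into-Y , start y₀)
        ; (inj₂ back) → xy∉Y (into-Y , back) }
      where
      into-Y : ArcWalk x y ya yb
      into-Y = arcWalk-to h m ++ₐ proj₁ e∈Y

    data StartsOutside : ∀ {a b} → Chain a b → Set f where
      []  : ∀ {x} → StartsOutside {x} {x} []
      _∷_ : ∀ {x w y z} {h : HW A₁ x w y} {no-back : ¬ HWalk A y x} {ch : Chain y z} →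
            NonY x w → StartsOutside ch → StartsOutside (((w , h) , no-back) ∷ ch)

    chain-outside : ∀ {a b} (ch : Chain a b) → StartsOutside ch → arcsᶜ ch ⊆ L →
                    AllArcs NonY (chain→walk ch)
    chain-outside [] [] _ ()
    chain-outside (((w , h) , _) ∷ ch) (out ∷ outs) ch⊆L =
      allArcs-++ (hwalk→walk h) (chain→walk ch) (outside-stays-outside h (λ m → ch⊆L (∈-++⁺ˡ m)) out)
                 (chain-outside ch outs (λ m → ch⊆L (∈-++⁺ʳ (arcsᴴ h) m)))

    first-step-into-Y : ∀ {a b} (ch : Chain a b) → (StartsOutside ch → ⊥) →
      (∀ {c d} (pre : Chain a c) (s : Strict c d) (post : Chain d b) → StartsOutside pre →
         InY c (proj₁ (proj₁ s)) → lenᶜ pre + (lenᵂ (proj₁ s) + lenᶜ post) ≡ lenᶜ ch →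
         arcsᶜ pre ⊆ arcsᶜ ch → arcsᵂ (proj₁ s) ⊆ arcsᶜ ch → arcsᶜ post ⊆ arcsᶜ ch → ⊥) → ⊥
    first-step-into-Y [] none-in-Y _ = none-in-Y []
    first-step-into-Y {a} (((w , h) , no-back) ∷ ch) none-in-Y first =
      by-cases (InY a w)
        (λ aw∈Y → first [] ((w , h) , no-back) ch [] aw∈Y refl (λ ()) ∈-++⁺ˡ (∈-++⁺ʳ (arcsᴴ h)))
        (λ aw∉Y → first-step-into-Y ch (λ outs → none-in-Y (aw∉Y ∷ outs))
           λ pre s post outs cd∈Y e pre⊆ s⊆ post⊆ →
             first (((w , h) , no-back) ∷ pre) s post (aw∉Y ∷ outs) cd∈Y
                   (trans (+-assoc (lenᴴ h) (lenᶜ pre) _) (cong (lenᴴ h +_) e))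
                   (λ m → [ ∈-++⁺ˡ , (λ k → ∈-++⁺ʳ (arcsᴴ h) (pre⊆ k)) ]′ (∈-++⁻ (arcsᴴ h) m))
                   (λ m → ∈-++⁺ʳ (arcsᴴ h) (s⊆ m))
                   (λ m → ∈-++⁺ʳ (arcsᴴ h) (post⊆ m)))

    leave-Y : ∀ {x y z} (h : HW A₁ x y z) → InY x y →
      (∀ p → InY p z → ⊥) →
      (∀ z′ y′ p (R : HW A₁ x y z′) (S₀ : HW A₁ z′ y′ z) → InY p z′ → NonY z′ y′ →
         lenᴴ R + lenᴴ S₀ ≡ lenᴴ h → arcsᴴ S₀ ⊆ arcsᴴ h → ⊥) → ⊥
    leave-Y (one a) xy∈Y ends-in-Y _ = ends-in-Y _ xy∈Y
    leave-Y {x} {y} (cons {w = w} a g h) xy∈Y ends-in-Y splits =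
      by-cases (InY y w)
        (λ yw∈Y → leave-Y h yw∈Y ends-in-Y λ z′ y′ p R S₀ p∈Y out e S₀⊆ →
           splits z′ y′ p (cons a g R) S₀ p∈Y out (cong suc e) (λ m → there (S₀⊆ m)))
        (λ yw∉Y → splits y w x (one a) h xy∈Y yw∉Y refl there)

    then-avoid : ∀ {z′ y′ z c} (S₀ : HW A₁ z′ y′ z) → arcsᴴ S₀ ⊆ L → NonY z′ y′ →
                 (ω : Walk z c) → AllArcs NonY ω → AllArcs NonY (hwalk→walk S₀ ++ʷ ω)
    then-avoid S₀ S₀⊆L out ω ω∉Y = allArcs-++ (hwalk→walk S₀) ω (outside-stays-outside S₀ S₀⊆L out) ω∉Y

    returns-to-start : ∀ {p z c} → InY p z → YTail c → (ω : Walk z c) → AllArcs NonY ω → z ≡ c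
    returns-to-start {z = z} {c} pz∈Y c∈Y ω ω∉Y with z ≟F c
    ... | yes z≡c = z≡c
    ... | no z≢c  = ⊥-elim (no-return-outside pz∈Y c∈Y z≢c ω ω∉Y)

    -- a closed chain of length ≤ N: rotate its first step into the closing walk
    no-closed-chain-within : ∀ {x} (ch : Chain x x) → 1 ≤ steps ch → lenᶜ ch ≤ N → ⊥
    no-closed-chain-within (s ∷ [])       _ _  = strict-irreflexive s
    no-closed-chain-within (s ∷ (t ∷ ch)) _ lb =
      IH (t ∷ ch) (s≤s z≤n) (proj₁ s) (subst (_≤ N) (+-comm (lenᵂ (proj₁ s)) _) lb)

    -- Past the point where s₁ leaves Y, the walk
    -- to c avoids Y, so it ends where it leaves Y; then mid, closed by the rest of s₁,
    -- is a shorter closed chain.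
    y-step-then-y-tail : ∀ {c₀ b₁ c} (s₁ : Strict c₀ b₁) → InY c₀ (proj₁ (proj₁ s₁)) →
      (mid : Chain b₁ c) → StartsOutside mid → YTail c → arcsᵂ (proj₁ s₁) ⊆ L → arcsᶜ mid ⊆ L →
      lenᵂ (proj₁ s₁) + lenᶜ mid ≤ suc N → ⊥
    y-step-then-y-tail ((y₁ , h₁) , no-back) c₀y₁∈Y [] _ (w , cw∈Y) _ _ _
      with unsnoc (proj₁ cw∈Y ++ₐ proj₂ c₀y₁∈Y)
    ... | inj₁ (c≡c₀ , _)     = strict-irreflexive (subst (Strict _) c≡c₀ ((y₁ , h₁) , no-back))
    ... | inj₂ (_ , back , _) = no-back (w , hwalk₁→hwalk (arcWalk→hwalk back))
    y-step-then-y-tail ((y₁ , h₁) , no-back) c₀y₁∈Y mid@(_ ∷ _) outs c∈Y s₁⊆L mid⊆L lb =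
      leave-Y h₁ c₀y₁∈Y
        (λ p end∈Y → case returns-to-start end∈Y c∈Y (chain→walk mid) mid∉Y of λ { refl →
           no-closed-chain-within mid (s≤s z≤n)
             (drop-positive (lenᴴ≥1 h₁) (subst (_≤ suc N) (+-comm (lenᴴ h₁) (lenᶜ mid)) lb)) })
        (λ z′ y′ p R S₀ p∈Y out e S₀⊆ →
           case returns-to-start p∈Y c∈Y (hwalk→walk S₀ ++ʷ chain→walk mid)
                  (then-avoid S₀ (λ m → s₁⊆L (S₀⊆ m)) out (chain→walk mid) mid∉Y) of λ { refl →
           IH mid (s≤s z≤n) (y′ , S₀)
             (subst (_≤ N) (+-comm (lenᴴ S₀) (lenᶜ mid))
                (≤-pred (≤-trans (+-mono-≤ (shorter (lenᴴ≥1 R) e) (≤-refl {lenᶜ mid})) lb))) })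
      where
      mid∉Y : AllArcs NonY (chain→walk mid)
      mid∉Y = chain-outside mid outs mid⊆L

    -- Past the point where s₁ leaves Y, the closed walk avoids Y until it comes
    -- back to c₀, so s₁ leaves Y at c₀; shortening s₁ accordingly gives a shorter chain.
    single-y-step : ∀ {a c₀ b₁ b} (pre : Chain a c₀) (s₁ : Strict c₀ b₁) (post : Chain b₁ b)
      (q : HWalk A₁ b a) →
      StartsOutside pre → InY c₀ (proj₁ (proj₁ s₁)) → StartsOutside post → NonY b (proj₁ q) →
      arcsᶜ pre ⊆ L → arcsᵂ (proj₁ s₁) ⊆ L → arcsᶜ post ⊆ L → arcsᵂ q ⊆ L →
      lenᶜ pre + (lenᵂ (proj₁ s₁) + lenᶜ post) + lenᵂ q ≤ suc N → ⊥
    single-y-step {c₀ = c₀} pre ((y₁ , h₁) , no-back) post (yq , hq) pre-out c₀y₁∈Y post-out q-out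
                  pre⊆L s₁⊆L post⊆L q⊆L lb =
      leave-Y h₁ c₀y₁∈Y
        (λ p end∈Y → strict-irreflexive
           (subst (Strict c₀) (returns-to-start end∈Y (y₁ , c₀y₁∈Y) rest rest∉Y) ((y₁ , h₁) , no-back)))
        (λ z′ y′ p R S₀ p∈Y out e S₀⊆ →
           case returns-to-start p∈Y (y₁ , c₀y₁∈Y) (hwalk→walk S₀ ++ʷ rest)
                  (then-avoid S₀ (λ m → s₁⊆L (S₀⊆ m)) out rest rest∉Y) of
             λ { refl → IH (pre ++ᶜ (((y′ , S₀) , no-back) ∷ post))
                   (steps-++-∷ pre ((y′ , S₀) , no-back) post)
                   (yq , hq)
                   (subst (λ k → k + lenᴴ hq ≤ N) (sym (lenᶜ-++ pre (((y′ , S₀) , no-back) ∷ post)))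
                      (≤-pred (≤-trans (grow (shorter (lenᴴ≥1 R) e)) lb))) })
      where
      rest : Walk _ c₀
      rest = chain→walk post ++ʷ (hwalk→walk hq ++ʷ chain→walk pre)
      rest∉Y : AllArcs NonY rest
      rest∉Y = allArcs-++ (chain→walk post) _ (chain-outside post post-out post⊆L)
                 (allArcs-++ (hwalk→walk hq) (chain→walk pre) (outside-stays-outside hq q⊆L q-out)
                    (chain-outside pre pre-out pre⊆L))
      grow : ∀ {s h} → suc s ≤ h →
             suc (lenᶜ pre + (s + lenᶜ post) + lenᴴ hq) ≤ lenᶜ pre + (h + lenᶜ post) + lenᴴ hq
      grow {s} {h} le =
        subst (_≤ lenᶜ pre + (h + lenᶜ post) + lenᴴ hq)
              (cong (_+ lenᴴ hq) (+-suc (lenᶜ pre) (s + lenᶜ post)))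
              (+-mono-≤ (+-mono-≤ (≤-refl {lenᶜ pre}) (+-mono-≤ le (≤-refl {lenᶜ post}))) (≤-refl {lenᴴ hq}))

    -- Past the point where q
    -- leaves Y, the closed walk avoids Y until it comes back to the start b of q, so
    -- q leaves Y at b, and the chain closed by the rest of q is shorter.
    y-closing-walk : ∀ {a b} (ch : Chain a b) (q : HWalk A₁ b a) → StartsOutside ch → InY b (proj₁ q) →
      1 ≤ steps ch → arcsᶜ ch ⊆ L → arcsᵂ q ⊆ L → lenᶜ ch + lenᵂ q ≤ suc N → ⊥
    y-closing-walk ch (yq , hq) outs byq∈Y nonempty ch⊆L q⊆L lb =
      leave-Y hq byq∈Y
        (λ p end∈Y → case returns-to-start end∈Y (yq , byq∈Y) (chain→walk ch) ch∉Y of λ { refl →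
           no-closed-chain-within ch nonempty (drop-positive (lenᴴ≥1 hq) lb) })
        (λ z′ y′ p R S₀ p∈Y out e S₀⊆ →
           case returns-to-start p∈Y (yq , byq∈Y) (hwalk→walk S₀ ++ʷ chain→walk ch)
                  (then-avoid S₀ (λ m → q⊆L (S₀⊆ m)) out (chain→walk ch) ch∉Y) of
             λ { refl → IH ch nonempty (y′ , S₀)
                   (≤-pred (≤-trans (subst (_≤ lenᶜ ch + lenᴴ hq) (+-suc (lenᶜ ch) (lenᴴ S₀))
                                      (+-mono-≤ (≤-refl {lenᶜ ch}) (shorter (lenᴴ≥1 R) e))) lb)) })
      where
      ch∉Y : AllArcs NonY (chain→walk ch)
      ch∉Y = chain-outside ch outs ch⊆L

    -- The induction step: y₀ lies on the chain or on the closing walk, so Y is met by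
    -- the first arc of some step or of the closing walk; each case gives a shorter
    -- closed chain.
    induction-step : ∀ {a b} (ch : Chain a b) → 1 ≤ steps ch → (q : HWalk A₁ b a) →
      lenᶜ ch + lenᵂ q ≤ suc N →
      arcsᶜ ch ⊆ L → arcsᵂ q ⊆ L → (ya , yb) ∈ arcsᶜ ch ⊎ (ya , yb) ∈ arcsᵂ q → ⊥
    induction-step {a} {b} ch nonempty (yq , hq) lb ch⊆L q⊆L y₀-on =
      first-step-into-Y ch
        (λ outs → by-cases (InY b yq)
           (λ byq∈Y → y-closing-walk ch (yq , hq) outs byq∈Y nonempty ch⊆L q⊆L lb)
           (λ q-out → [ (λ m → chain-outside ch outs ch⊆L (subst (_ ∈_) (sym (arcsᶜ-walk ch)) m) y₀∈Y)
                      , (λ m → outside-stays-outside hq q⊆L q-out m y₀∈Y) ]′ y₀-on))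
        (λ pre s₁ post pre-out y∈Y e pre⊆ s₁⊆ post⊆ →
           first-step-into-Y post
             (λ post-out → by-cases (InY b yq)
                (λ byq∈Y → y-step-then-y-tail s₁ y∈Y post post-out (yq , byq∈Y) (λ m → ch⊆L (s₁⊆ m))
                             (λ m → ch⊆L (post⊆ m)) (≤-trans (tail≤ pre s₁ post e) ch≤))
                (λ q-out → single-y-step pre s₁ post (yq , hq) pre-out y∈Y post-out q-out
                             (λ m → ch⊆L (pre⊆ m)) (λ m → ch⊆L (s₁⊆ m)) (λ m → ch⊆L (post⊆ m)) q⊆L
                             (subst (λ k → k + lenᴴ hq ≤ suc N) (sym e) lb)))
             (λ mid s₂ _ mid-out y∈Y′ e′ mid⊆ _ _ →
                y-step-then-y-tail s₁ y∈Y mid mid-out (proj₁ (proj₁ s₂) , y∈Y′) (λ m → ch⊆L (s₁⊆ m))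
                  (λ m → ch⊆L (post⊆ (mid⊆ m)))
                  (≤-trans (+-mono-≤ (≤-refl {lenᵂ (proj₁ s₁)}) (subst (lenᶜ mid ≤_) e′ (m≤m+n (lenᶜ mid) _)))
                     (≤-trans (tail≤ pre s₁ post e) ch≤))))
      where
      ch≤ : lenᶜ ch ≤ suc N
      ch≤ = ≤-trans (m≤m+n (lenᶜ ch) (lenᴴ hq)) lb
      tail≤ : ∀ {c d} (pre : Chain a c) (s₁ : Strict c d) (post : Chain d b) →
              lenᶜ pre + (lenᵂ (proj₁ s₁) + lenᶜ post) ≡ lenᶜ ch →
              lenᵂ (proj₁ s₁) + lenᶜ post ≤ lenᶜ ch
      tail≤ pre s₁ post e = subst (lenᵂ (proj₁ s₁) + lenᶜ post ≤_) e (m≤n+m _ (lenᶜ pre))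

  -- Induction on N: take y₀ minimal for Reaches among the arcs of the chain and of
  -- the closing walk, and apply the induction step.
  no-closed-chain-upto : ∀ N → NoClosedChainUpTo N
  no-closed-chain-upto zero ch _ (_ , hq) lb
    with () ← ≤-trans (≤-trans (lenᴴ≥1 hq) (m≤n+m (lenᴴ hq) (lenᶜ ch))) lb
  no-closed-chain-upto (suc N) ch nonempty (yq , hq) lb =
    minimal-exists Reaches (λ _ → ⊤) (inj₁ refl) Reaches-trans used
      (λ none → none (_ , ∈-++⁺ʳ (arcsᶜ ch) (firstArc∈ hq) , tt))
      λ { ((ya , yb) , y₀∈ , _ , y₀-min) →
          InductionStep.induction-step N (no-closed-chain-upto N) used (valid y₀∈) (λ e∈ → y₀-min e∈ tt)
            ch nonempty (yq , hq) lb ∈-++⁺ˡ (∈-++⁺ʳ (arcsᶜ ch)) (∈-++⁻ (arcsᶜ ch) y₀∈) }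
    where
    used : List (V × V)
    used = arcsᶜ ch ++ arcsᴴ hq
    valid : ∀ {e} → e ∈ used → A₁ (proj₁ e) (proj₂ e)
    valid m with ∈-++⁻ (arcsᶜ ch) m
    ... | inj₁ k = arc∈walk-valid (chain→walk ch) (subst (_ ∈_) (sym (arcsᶜ-walk ch)) k)
    ... | inj₂ k = arc∈walk-valid (hwalk→walk hq) k

  -- a closed chain is a chain closed by the H-walk of its first step
  no-closed-chain : ∀ {x y} → Strict x y → Chain y x → ⊥
  no-closed-chain s []       = strict-irreflexive s
  no-closed-chain s (t ∷ ch) = no-closed-chain-upto _ (t ∷ ch) (s≤s z≤n) (proj₁ s) ≤-refl

  -- The H-semikernel digraph is acyclic: along a directed cycle S₀ → S₁ → … of
  -- semikernels some vertex leaves some Sᵢ, and no leaving vertex is minimal for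
  -- reachability by chains, which is impossible in the finite set of positions.
  semikernel-digraph-acyclic : Acyclic SKArc
  semikernel-digraph-acyclic cyc =
    minimal-exists Below Leaves (λ {e} → Below-refl {e}) (λ {e₁ e₂ e₃} → Below-trans {e₁} {e₂} {e₃})
                   positions some-vertex-leaves no-minimal-leaver
    where
    S : Fin (suc (len cyc)) → Subset n
    S i = proj₁ (vtx cyc i)

    Position : Set
    Position = Fin (suc (len cyc)) × V

    Leaves : Position → Set
    Leaves (i , s) = s ∈ₛ S i × s ∉ₛ S (nextF i)

    positions : List Position
    positions = cartesianProduct (allFin _) (allFin n)

    everywhere : ∀ e → e ∈ positions
    everywhere (i , s) = ∈-cartesianProduct⁺ (∈-allFin i) (∈-allFin s)

    Below : Position → Position → Set f
    Below e m = Chain (proj₂ m) (proj₂ e)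

    Below-refl : ∀ {e} → Below e e
    Below-refl = []

    Below-trans : ∀ {e₁ e₂ e₃} → Below e₁ e₂ → Below e₂ e₃ → Below e₁ e₃
    Below-trans c₁₂ c₂₃ = c₂₃ ++ᶜ c₁₂

    stays : ∀ s → (∀ j → ¬ Leaves (j , s)) → ∀ j → s ∈ₛ S j → s ∈ₛ S (nextF j)
    stays s never j s∈ with s ∈ₛ? S (nextF j)
    ... | yes s∈′ = s∈′
    ... | no s∉′  = ⊥-elim (never j (s∈ , s∉′))

    leaves-somewhere : ∀ {s i₀ i₁} → s ∈ₛ S i₀ → s ∉ₛ S i₁ → ¬ ¬ (∃[ j ] Leaves (j , s))
    leaves-somewhere {s} {i₁ = i₁} s∈ s∉ never =
      s∉ (around-the-cycle (λ j → s ∈ₛ S j) (stays s (λ j l → never (j , l))) s∈ i₁)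

    -- S₀ ≠ S₁, so some vertex leaves somewhere
    some-vertex-leaves : ¬ ¬ (∃[ e ] (e ∈ positions × Leaves e))
    some-vertex-leaves none = proj₁ (arcs cyc zero) (⊆-antisym S₀⊆S₁ S₁⊆S₀)
      where
      never : ∀ s j → ¬ Leaves (j , s)
      never s j l = none ((j , s) , everywhere (j , s) , l)
      S₀⊆S₁ : S zero ⊆ₛ S (nextF zero)
      S₀⊆S₁ {s} = stays s (never s) zero
      S₁⊆S₀ : S (nextF zero) ⊆ₛ S zero
      S₁⊆S₀ {s} s∈ = around-the-cycle (λ j → s ∈ₛ S j) (stays s (never s)) s∈ zero

    -- the arc Sᵢ → Sᵢ₊₁ sends a vertex s leaving at i by a strict step to a vertex s₂
    -- that leaves later; if s were minimal, s₂ would chain back to s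
    no-minimal-leaver : ¬ ∃ (Minimal Below Leaves positions)
    no-minimal-leaver ((i , s) , _ , (s∈ , s∉) , minimal)
      with proj₂ (arcs cyc i) s s∈ s∉
    ... | s₂ , s₂∈ , s₂∉ , walk , no-back =
      leaves-somewhere s₂∈ s₂∉ λ { (j , l) →
        minimal (everywhere (j , s₂)) l (strict ∷ []) (no-closed-chain strict) }
      where
      strict : Strict s s₂
      strict = walk , no-back s s∈

theorem3 : ∀ {u f : Level} (n : ℕ) (E₁ E₂ : Fin n → Fin n → Bool)
    (U : Set u) (F : U → U → Set f) (ς : Fin n → Fin n → U) →
    (∀ x → E₁ x x ≡ false) →
    (∀ x → E₂ x x ≡ false) →
    (∀ x y → ¬ (T (E₁ x y) × T (E₂ x y))) →
    (∀ (c : DirCycle (Setting.A₁ n E₁ E₂ U F ς)) →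
    Setting.IsHCycle n E₁ E₂ U F ς c) →
    Acyclic (Setting.SKArc n E₁ E₂ U F ς)
theorem3 n E₁ E₂ U F ς E₁-loopless _ _ E₁-cycles-are-H =
  Acyclicity.semikernel-digraph-acyclic n E₁ E₂ U F ς E₁-loopless E₁-cycles-are-H
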